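{- Let $(B,\sqsubseteq)$ be a bounded complete predomain base. Then its continuous completion $(\hat B,\sqsubseteq)$ has suprema of all increasing chains.
   Context: Work constructively; $\tilde\exists x.A$ abbreviates $\neg\forall x.\neg A$. In a poset, a chain is a sequence $(x_n)$ with $x_n\sqsubseteq x_{n+1}$; $b\ll c$ means: for every chain $(x_n)$ whose supremum exists and satisfies $c\sqsubseteq\bigsqcup_n x_n$, there weakly exists $n$ with $b\sqsubseteq x_n$. An approximating sequence of $b$ is a chain $(b_n)$ with $b_n\ll b$ for all $n$ and $\bigsqcup_n b_n=b$. A predomain base is a countable poset with decidable order in which every element has an approximating sequence. A nonempty finite subset is consistent if it weakly has an upper bound; bounded complete means every finite consistent subset has a least upper bound. The continuous completion $\hat B$ is the set of increasing sequences $(b_n)_n$ in $B$, preordered by $(b_n)\sqsubseteq(b'_n)$ iff for all $b\in B$ and $n\in\mathbb N$, $b\ll b_n$ (in $B$) implies $\tilde\exists m.\,b\ll b'_m$; equality on $\hat B$ is mutual $\sqsubseteq$, making $\hat B$ a poset, and suprema in $\hat B$ refer to this order. -}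

module Defs where

open import Level using (0ℓ)
open import Data.Nat using (ℕ; suc)
open import Data.Fin using (Fin)
open import Data.Maybe using (Maybe; just)
open import Data.Product using (Σ; Σ-syntax; _×_; proj₁)
open import Relation.Nullary using (¬_)
open import Relation.Binary.Definitions using (Decidable)
open import Relation.Binary.Bundles using (Poset)
open import Relation.Binary.PropositionalEquality using (_≡_)

∃̃ : (A : Set) → (A → Set) → Set
∃̃ A P = ¬ ((x : A) → ¬ P x)

module Order {C : Set} (_≤_ : C → C → Set) where

  IsChain : (ℕ → C) → Set
  IsChain x = (n : ℕ) → x n ≤ x (suc n)

  IsSup : (ℕ → C) → C → Set
  IsSup x s = ((n : ℕ) → x n ≤ s) × ((u : C) → ((n : ℕ) → x n ≤ u) → s ≤ u)

  _≪_ : C → C → Set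
  b ≪ c = (x : ℕ → C) → IsChain x → (s : C) → IsSup x s → c ≤ s →
          ∃̃ ℕ (λ n → b ≤ x n)

  IsApproximatingSeq : (ℕ → C) → C → Set
  IsApproximatingSeq bs b = IsChain bs × ((n : ℕ) → bs n ≪ b) × IsSup bs b

  -- a nonempty finite subset, given as a family indexed by Fin (suc k)
  IsUpperBound : {k : ℕ} → (Fin (suc k) → C) → C → Set
  IsUpperBound F u = (i : Fin _) → F i ≤ u

  IsLeastUpperBound : {k : ℕ} → (Fin (suc k) → C) → C → Set
  IsLeastUpperBound F s = IsUpperBound F s × ((u : C) → IsUpperBound F u → s ≤ u)

  Consistent : {k : ℕ} → (Fin (suc k) → C) → Set
  Consistent F = ∃̃ C (IsUpperBound F)

  BoundedComplete : Set
  BoundedComplete = (k : ℕ) (F : Fin (suc k) → C) → Consistent F →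
                    Σ[ s ∈ C ] IsLeastUpperBound F s

module _ (B : Poset 0ℓ 0ℓ 0ℓ) where
  open Poset B renaming (Carrier to ∣B∣; _≤_ to _⊑_)
  open Order _⊑_

  -- countable: enumerated (possibly with gaps, to allow the empty case) by ℕ
  Countable : Set
  Countable = Σ[ e ∈ (ℕ → Maybe ∣B∣) ] ((b : ∣B∣) → Σ[ n ∈ ℕ ] e n ≡ just b)

  IsPredomainBase : Set
  IsPredomainBase = Countable × Decidable _⊑_ ×
                    ((b : ∣B∣) → Σ[ bs ∈ (ℕ → ∣B∣) ] IsApproximatingSeq bs b)

  IsBoundedComplete : Set
  IsBoundedComplete = BoundedComplete

  B̂ : Set
  B̂ = Σ[ x ∈ (ℕ → ∣B∣) ] IsChain x

  _⊑̂_ : B̂ → B̂ → Set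
  x ⊑̂ y = (b : ∣B∣) (n : ℕ) → b ≪ proj₁ x n → ∃̃ ℕ (λ m → b ≪ proj₁ y m)

  HasChainSuprema : Set
  HasChainSuprema = (X : ℕ → B̂) → Order.IsChain _⊑̂_ X →
                    Σ[ S ∈ B̂ ] Order.IsSup _⊑̂_ X S

module Submission where

-- Given a ⊑̂-chain X of increasing sequences x k, the supremum is the
-- sequence S of running joins  S n = g 0 ⊔ … ⊔ g n  where g enumerates ALL
-- approximants  approx (x k m) i  (k, m, i ∈ ℕ).  These joins exist by
-- bounded completeness because everything stays (weakly) way below a single
-- member x K M of the family, which is ≪-directed since X is a ⊑̂-chain.

open import Defs
open import Level using (0ℓ)
open import Relation.Binary.Bundles using (Poset)
open import Relation.Binary.Definitions using (Decidable)
open import Data.Nat using (ℕ; zero; suc; _+_; _≤_; _⊔_; _≤′_; ≤′-refl; ≤′-step)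
open import Data.Nat.Properties using (+-suc; +-identityʳ; ≤⇒≤′; m≤m⊔n; m≤n⊔m)
open import Data.Fin using (Fin; zero; suc)
open import Data.Product using (Σ; Σ-syntax; _×_; _,_; proj₁; proj₂)
open import Relation.Nullary.Negation using (DoubleNegation; ¬¬-Monad)
open import Relation.Nullary.Decidable using (decidable-stable)
open import Effect.Monad using (RawMonad)
open import Relation.Binary.PropositionalEquality
  using (_≡_; refl; sym; trans; cong; module ≡-Reasoning)

open RawMonad (¬¬-Monad {0ℓ}) using (pure; _>>=_)

weakly : {A : Set} {P : A → Set} → ∃̃ A P → DoubleNegation (Σ A P)
weakly e k = e (λ a p → k (a , p))

weak : {A : Set} {P : A → Set} → DoubleNegation (Σ A P) → ∃̃ A P
weak h f = h (λ (a , p) → f a p)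

chain-mono : {C : Set} (R : C → C → Set) →
             (∀ {a} → R a a) → (∀ {a b c} → R a b → R b c → R a c) →
             (x : ℕ → C) → Order.IsChain R x → ∀ {i j} → i ≤ j → R (x i) (x j)
chain-mono R R-refl R-trans x x-chain i≤j = along (≤⇒≤′ i≤j)
  where
  along : ∀ {i j} → i ≤′ j → R (x i) (x j)
  along ≤′-refl = R-refl
  along (≤′-step i≤j) = R-trans (along i≤j) (x-chain _)


-- 1. Enumerations: e : ℕ → I is onto.  Running joins need all approximants
-- of a family as one sequence; enumerating the index set provides it.
Enumeration : Set → Set
Enumeration I = Σ[ e ∈ (ℕ → I) ] ((i : I) → Σ[ n ∈ ℕ ] e n ≡ i)

ℕ-enumeration : Enumeration ℕ
ℕ-enumeration = (λ n → n) , (λ n → n , refl)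

-- Cantor's zig-zag: walk down the current antidiagonal a + b = d, and jump
-- to the start (d + 1 , 0) of the next one at its end.
next : ℕ × ℕ → ℕ × ℕ
next (zero , b) = (suc b , zero)
next (suc a , b) = (a , suc b)

unpair : ℕ → ℕ × ℕ
unpair zero = (zero , zero)
unpair (suc n) = next (unpair n)

unpair-walk : ∀ k a b n → unpair n ≡ (k + a , b) → unpair (k + n) ≡ (a , b + k)
unpair-walk zero a b n eq = trans eq (cong (a ,_) (sym (+-identityʳ b)))
unpair-walk (suc k) a b n eq = begin
  unpair (suc (k + n))  ≡⟨ cong unpair (sym (+-suc k n)) ⟩
  unpair (k + suc n)    ≡⟨ unpair-walk k a (suc b) (suc n) (cong next eq) ⟩
  (a , suc (b + k))     ≡⟨ cong (a ,_) (sym (+-suc b k)) ⟩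
  (a , b + suc k)       ∎
  where open ≡-Reasoning

unpair-diagonal : ∀ d → Σ[ n ∈ ℕ ] unpair n ≡ (d , zero)
unpair-diagonal zero = zero , refl
unpair-diagonal (suc d) with unpair-diagonal d
... | n , eq = suc (d + n) , cong next (unpair-walk d zero zero n d+0)
  where
  d+0 : unpair n ≡ (d + zero , zero)
  d+0 = trans eq (cong (_, zero) (sym (+-identityʳ d)))

unpair-onto : ∀ a b → Σ[ n ∈ ℕ ] unpair n ≡ (a , b)
unpair-onto a b with unpair-diagonal (b + a)
... | n , eq = b + n , unpair-walk b a zero n eq

×-enumeration : {I J : Set} → Enumeration I → Enumeration J → Enumeration (I × J)
×-enumeration {I} {J} (e , e-onto) (f , f-onto) = enum , onto
  where
  enum : ℕ → I × J
  enum n = e (proj₁ (unpair n)) , f (proj₂ (unpair n))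

  onto : (ij : I × J) → Σ[ n ∈ ℕ ] enum n ≡ ij
  onto (i , j) with e-onto i | f-onto j
  ... | a , refl | b , refl with unpair-onto a b
  ...   | n , eq = n , cong (λ (a , b) → e a , f b) eq

module Completion (B : Poset 0ℓ 0ℓ 0ℓ) where
  open Poset B renaming (Carrier to C; _≤_ to _⊑_; refl to ⊑-refl; trans to ⊑-trans)
  open Order _⊑_

  ⊑-chain-mono : (x : ℕ → C) → IsChain x → ∀ {i j} → i ≤ j → x i ⊑ x j
  ⊑-chain-mono = chain-mono _⊑_ ⊑-refl ⊑-trans

  ≪-⊑-trans : ∀ {b c d} → b ≪ c → c ⊑ d → b ≪ d
  ≪-⊑-trans b≪c c⊑d x x-chain s s-sup d⊑s = b≪c x x-chain s s-sup (⊑-trans c⊑d d⊑s)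

  ⊑-≪-trans : ∀ {a b c} → a ⊑ b → b ≪ c → a ≪ c
  ⊑-≪-trans a⊑b b≪c x x-chain s s-sup c⊑s = weak do
    (n , b⊑xn) ← weakly (b≪c x x-chain s s-sup c⊑s)
    pure (n , ⊑-trans a⊑b b⊑xn)

  -- Test b ≪ c against the constant chain at c.
  ≪⇒¬¬⊑ : ∀ {b c} → b ≪ c → DoubleNegation (b ⊑ c)
  ≪⇒¬¬⊑ {b} {c} b≪c = do
    (_ , b⊑c) ← weakly (b≪c (λ _ → c) (λ _ → ⊑-refl) c constant-sup ⊑-refl)
    pure b⊑c
    where
    constant-sup : IsSup (λ _ → c) c
    constant-sup = (λ _ → ⊑-refl) , (λ u c⊑u → c⊑u 0)

  pair : C → C → Fin 2 → C
  pair s t zero = s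
  pair s t (suc zero) = t

  pair-ub : ∀ {s t u} → s ⊑ u → t ⊑ u → IsUpperBound (pair s t) u
  pair-ub s⊑u t⊑u zero = s⊑u
  pair-ub s⊑u t⊑u (suc zero) = t⊑u

  join-≪ : ∀ {s t l c} → IsLeastUpperBound (pair s t) l → s ≪ c → t ≪ c → l ≪ c
  join-≪ (_ , l-least) s≪c t≪c x x-chain p p-sup c⊑p = weak do
    (i , s⊑xi) ← weakly (s≪c x x-chain p p-sup c⊑p)
    (j , t⊑xj) ← weakly (t≪c x x-chain p p-sup c⊑p)
    pure (i ⊔ j , l-least (x (i ⊔ j))
      (pair-ub (⊑-trans s⊑xi (⊑-chain-mono x x-chain (m≤m⊔n i j)))
               (⊑-trans t⊑xj (⊑-chain-mono x x-chain (m≤n⊔m i j)))))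

  record JoinClosed (P : C → Set) : Set where
    field
      consistent : ∀ {s t} → P s → P t → Consistent (pair s t)
      join-∈     : ∀ {s t l} → P s → P t → IsLeastUpperBound (pair s t) l → P l

  record ChainAbove (P : C → Set) (g : ℕ → C) : Set where
    field
      S       : ℕ → C
      S-chain : IsChain S
      S-∈     : ∀ n → P (S n)
      g⊑S     : ∀ n → g n ⊑ S n

  module _ (bc : BoundedComplete) where

    -- In a bounded complete poset, S n = g 0 ⊔ … ⊔ g n exists whenever all
    -- g n lie in a join-closed P, since then S n ∈ P is consistent with g (n+1).
    running-joins : ∀ {P} → JoinClosed P → (g : ℕ → C) → (∀ n → P (g n)) →
                    ChainAbove P g
    running-joins {P} closed g g-∈ = record
      { S = S ; S-chain = S-chain ; S-∈ = S-∈ ; g⊑S = g⊑S }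
      where
      open JoinClosed closed

      join-with-next : (n : ℕ) (s : Σ C P) → Σ C (IsLeastUpperBound (pair (proj₁ s) (g (suc n))))
      join-with-next n (s , s-∈) = bc 1 (pair s (g (suc n))) (consistent s-∈ (g-∈ (suc n)))

      running : ℕ → Σ C P
      running zero = g 0 , g-∈ 0
      running (suc n) with join-with-next n (running n)
      ... | l , l-join = l , join-∈ (proj₂ (running n)) (g-∈ (suc n)) l-join

      S : ℕ → C
      S n = proj₁ (running n)

      S-∈ : ∀ n → P (S n)
      S-∈ n = proj₂ (running n)

      S-chain : IsChain S
      S-chain n with join-with-next n (running n)
      ... | _ , l-ub , _ = l-ub zero

      g⊑S : ∀ n → g n ⊑ S n
      g⊑S zero = ⊑-refl
      g⊑S (suc n) with join-with-next n (running n)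
      ... | _ , l-ub , _ = l-ub (suc zero)

    ≪-Directed : {I : Set} → (I → C) → Set
    ≪-Directed {I} y = ∀ {s t i j} → s ≪ y i → t ≪ y j → ∃̃ I (λ k → s ≪ y k × t ≪ y k)

    WayBelowSome : {I : Set} → (I → C) → C → Set
    WayBelowSome {I} y s = ∃̃ I (λ i → s ≪ y i)

    directed-join-closed : {I : Set} (y : I → C) → ≪-Directed y → JoinClosed (WayBelowSome y)
    directed-join-closed y directed = record
      { consistent = λ s-∈ t-∈ → weak do
          (i , s≪yi) ← weakly s-∈
          (j , t≪yj) ← weakly t-∈
          (k , s≪yk , t≪yk) ← weakly (directed s≪yi t≪yj)
          s⊑yk ← ≪⇒¬¬⊑ s≪yk
          t⊑yk ← ≪⇒¬¬⊑ t≪yk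
          pure (y k , pair-ub s⊑yk t⊑yk)
      ; join-∈ = λ s-∈ t-∈ l-join → weak do
          (i , s≪yi) ← weakly s-∈
          (j , t≪yj) ← weakly t-∈
          (k , s≪yk , t≪yk) ← weakly (directed s≪yi t≪yj)
          pure (k , join-≪ l-join s≪yk t≪yk)
      }

    chain-≪-directed : (x : ℕ → C) → IsChain x → ≪-Directed x
    chain-≪-directed x x-chain {i = i} {j} s≪xi t≪xj = weak (pure
      (i ⊔ j , ≪-⊑-trans s≪xi (⊑-chain-mono x x-chain (m≤m⊔n i j))
             , ≪-⊑-trans t≪xj (⊑-chain-mono x x-chain (m≤n⊔m i j))))

    module _ (approximating : (b : C) → Σ[ bs ∈ (ℕ → C) ] IsApproximatingSeq bs b) where

      approx : C → ℕ → C
      approx c = proj₁ (approximating c)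

      approx-chain : ∀ c → IsChain (approx c)
      approx-chain c = proj₁ (proj₂ (approximating c))

      approx-≪ : ∀ c n → approx c n ≪ c
      approx-≪ c = proj₁ (proj₂ (proj₂ (approximating c)))

      approx-sup : ∀ c → IsSup (approx c) c
      approx-sup c = proj₂ (proj₂ (proj₂ (approximating c)))

      record ApproximantJoins {I : Set} (y : I → C) : Set where
        field
          S       : ℕ → C
          S-chain : IsChain S
          S-≪     : ∀ n → WayBelowSome y (S n)
          covers  : ∀ i j → Σ[ n ∈ ℕ ] approx (y i) j ⊑ S n

      approximant-joins : {I : Set} → Enumeration I → (y : I → C) → ≪-Directed y →
                          ApproximantJoins y
      approximant-joins {I} enumI y directed = record
        { S = S ; S-chain = S-chain ; S-≪ = S-∈ ; covers = covers }
        where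
        enum = ×-enumeration enumI ℕ-enumeration

        g : ℕ → C
        g n = approx (y (proj₁ (proj₁ enum n))) (proj₂ (proj₁ enum n))

        g-∈ : ∀ n → WayBelowSome y (g n)
        g-∈ n = weak (pure (_ , approx-≪ _ _))

        open ChainAbove (running-joins (directed-join-closed y directed) g g-∈)

        covers : ∀ i j → Σ[ n ∈ ℕ ] approx (y i) j ⊑ S n
        covers i j with proj₂ enum (i , j)
        ... | n , refl = n , g⊑S n

      -- Interpolation: if ⊑ is decidable, b ≪ c is witnessed by an
      -- approximant of c.  The approximant joins of c have supremum c.
      interpolate : Decidable _⊑_ → ∀ {b c} → b ≪ c → ∃̃ ℕ (λ N → b ≪ approx c N)
      interpolate _⊑?_ {b} {c} b≪c = weak do
        (n , b⊑Sn) ← weakly (b≪c S S-chain c S-sup ⊑-refl)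
        (N , Sn≪aN) ← weakly (S-≪ n)
        pure (N , ⊑-≪-trans b⊑Sn Sn≪aN)
        where
        open ApproximantJoins
          (approximant-joins ℕ-enumeration (approx c) (chain-≪-directed _ (approx-chain c)))

        S⊑c : ∀ n → S n ⊑ c
        S⊑c n = decidable-stable (S n ⊑? c) do
          (N , Sn≪aN) ← weakly (S-≪ n)
          Sn⊑aN ← ≪⇒¬¬⊑ Sn≪aN
          pure (⊑-trans Sn⊑aN (proj₁ (approx-sup c) N))

        S-least : ∀ u → (∀ n → S n ⊑ u) → c ⊑ u
        S-least u S⊑u = proj₂ (approx-sup c) u λ i → proj₂ (approx-sup (approx c i)) u λ j →
          let (n , a⊑Sn) = covers i j in ⊑-trans a⊑Sn (S⊑u n)

        S-sup : IsSup S c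
        S-sup = S⊑c , S-least

  ⊑̂-refl : ∀ {X} → _⊑̂_ B X X
  ⊑̂-refl b n b≪xn = weak (pure (n , b≪xn))

  ⊑̂-trans : ∀ {X Y Z} → _⊑̂_ B X Y → _⊑̂_ B Y Z → _⊑̂_ B X Z
  ⊑̂-trans X⊑Y Y⊑Z b n b≪xn = weak do
    (m , b≪ym) ← weakly (X⊑Y b n b≪xn)
    weakly (Y⊑Z b m b≪ym)

  entries : (ℕ → B̂ B) → ℕ × ℕ → C
  entries X (k , m) = proj₁ (X k) m

  -- The entries of a ⊑̂-chain are ≪-directed: move both elements to row
  -- k ⊔ k', then along that row.
  ⊑̂-chain-≪-directed : (bc : BoundedComplete) (X : ℕ → B̂ B) → Order.IsChain (_⊑̂_ B) X →
                        ≪-Directed bc (entries X)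
  ⊑̂-chain-≪-directed bc X X-chain {s} {t} {k , m} {k' , m'} s≪xkm t≪xk'm' = weak do
    (m₁ , s≪x₁) ← weakly (X-mono (m≤m⊔n k k') s m s≪xkm)
    (m₂ , t≪x₂) ← weakly (X-mono (m≤n⊔m k k') t m' t≪xk'm')
    (j , s≪xj , t≪xj) ← weakly (chain-≪-directed bc _ (proj₂ (X (k ⊔ k'))) s≪x₁ t≪x₂)
    pure ((k ⊔ k' , j) , s≪xj , t≪xj)
    where
    X-mono : ∀ {i j} → i ≤ j → _⊑̂_ B (X i) (X j)
    X-mono = chain-mono (_⊑̂_ B) (λ {X} → ⊑̂-refl {X}) (λ {X} {Y} {Z} → ⊑̂-trans {X} {Y} {Z}) X X-chain

-- The supremum of a ⊑̂-chain X is the chain of running joins of all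
-- approximants of all x k m: each b ≪ x k j interpolates below an
-- approximant of x k j (upper bound), and each term is weakly way below
-- some x k m (least upper bound).
corollary3p5 : (B : Poset 0ℓ 0ℓ 0ℓ) → IsPredomainBase B → IsBoundedComplete B →
    HasChainSuprema B
corollary3p5 B (_ , _⊑?_ , approximating) bc X X-chain = (S , S-chain) , X⊑S , S-least
  where
  open Completion B
  open ApproximantJoins
    (approximant-joins bc approximating (×-enumeration ℕ-enumeration ℕ-enumeration)
      (entries X) (⊑̂-chain-≪-directed bc X X-chain))

  X⊑S : ∀ k → _⊑̂_ B (X k) (S , S-chain)
  X⊑S k b j b≪xkj = weak do
    (N , b≪a) ← weakly (interpolate bc approximating _⊑?_ b≪xkj)
    let (n , a⊑Sn) = covers (k , j) N
    pure (n , ≪-⊑-trans b≪a a⊑Sn)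

  S-least : (U : B̂ B) → (∀ k → _⊑̂_ B (X k) U) → _⊑̂_ B (S , S-chain) U
  S-least U X⊑U b n b≪Sn = weak do
    ((k , m) , Sn≪xkm) ← weakly (S-≪ n)
    Sn⊑xkm ← ≪⇒¬¬⊑ Sn≪xkm
    weakly (X⊑U k b m (≪-⊑-trans b≪Sn Sn⊑xkm))
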